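{- Let $G$ be a digraph and $\mathcal P\subseteq G$ a subgraph. Let $\mathcal R$ be a $\mathcal P$-minimal linkage between two sets $A$ and $B$ (i.e. an $A$-$B$ linkage), and let $r:=|\mathcal R|$. Let $R\in\mathcal R$ and $e\in E(R)\setminus E(\mathcal P)$, and let $R_1,R_2$ be the two components of $R-e$, where the tail of $e$ lies in $R_1$. Then there are at most $r$ pairwise vertex-disjoint paths from $R_1$ to $R_2$ in $\mathcal P\cup\mathcal R$.
   Context: All paths are directed. A linkage is a set of pairwise vertex-disjoint paths; an $A$-$B$ linkage consists of paths from $A$ to $B$; its order is the number of its paths. For a subgraph $H$ of $G$, an $A$-$B$ linkage $\mathcal L$ of order $k$ is $H$-minimal if for every edge $e\in\bigcup_{P\in\mathcal L}E(P)\setminus E(H)$ there is no $A$-$B$ linkage of order $k$ in $(\bigcup\mathcal L\cup H)-e$. $\mathcal P\cup\mathcal R$ denotes the subgraph $\mathcal P\cup\bigcup_{R\in\mathcal R}R$. -}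

module Defs where

open import Data.Nat using (ℕ)
open import Data.Fin using (Fin)
open import Data.Product using (Σ; _×_; _,_; proj₁; proj₂)
open import Data.Sum using (_⊎_)
open import Data.Unit using (⊤)
open import Data.List using (List; []; _∷_; length; concatMap)
open import Data.List.Membership.Propositional using (_∈_)
open import Data.List.Relation.Unary.All using (All)
open import Data.List.Relation.Unary.Any using (Any)
open import Data.List.Relation.Unary.AllPairs using (AllPairs)
open import Data.List.Relation.Unary.Unique.Propositional using (Unique)
open import Data.List.Relation.Binary.Disjoint.Propositional using (Disjoint)
open import Relation.Binary.PropositionalEquality using (_≡_)
open import Relation.Nullary using (¬_)

-- Vertices are Fin n; an (ordered) edge is a pair (tail , head).
Edge : ℕ → Set
Edge n = Fin n × Fin n

record Digraph (n : ℕ) : Set₁ where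
  field
    Arc : Edge n → Set
open Digraph public

record Gr (n : ℕ) : Set₁ where
  field
    inV : Fin n → Set
    inE : Edge n → Set
open Gr public

whole : ∀ {n} → Digraph n → Gr n
whole G = record { inV = λ _ → ⊤ ; inE = Arc G }

record SubgraphOf {n : ℕ} (H : Gr n) (G : Digraph n) : Set where
  field
    edgeSub : ∀ e → inE H e → Arc G e
    tailIn  : ∀ e → inE H e → inV H (proj₁ e)
    headIn  : ∀ e → inE H e → inV H (proj₂ e)

-- A (candidate) path: its first vertex followed by the remaining vertices in order.
record Path (n : ℕ) : Set where
  constructor path
  field
    start : Fin n
    rest  : List (Fin n)
open Path public

verts : ∀ {n} → Path n → List (Fin n)
verts p = start p ∷ rest p

lastFrom : ∀ {n} → Fin n → List (Fin n) → Fin n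
lastFrom v []       = v
lastFrom v (w ∷ ws) = lastFrom w ws

end : ∀ {n} → Path n → Fin n
end p = lastFrom (start p) (rest p)

arcsFrom : ∀ {n} → Fin n → List (Fin n) → List (Edge n)
arcsFrom v []       = []
arcsFrom v (w ∷ ws) = (v , w) ∷ arcsFrom w ws

arcs : ∀ {n} → Path n → List (Edge n)
arcs p = arcsFrom (start p) (rest p)

IsPathIn : ∀ {n} → Gr n → Path n → Set
IsPathIn H p = Unique (verts p) × All (inV H) (verts p) × All (inE H) (arcs p)

IsLinkage : ∀ {n} → Gr n → (A B : Fin n → Set) → List (Path n) → Set
IsLinkage H A B ℒ =
  All (λ p → IsPathIn H p × A (start p) × B (end p)) ℒ
  × AllPairs (λ p q → Disjoint (verts p) (verts q)) ℒ

_∪ᴸ_ : ∀ {n} → List (Path n) → Gr n → Gr n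
ℒ ∪ᴸ H = record
  { inV = λ v → inV H v ⊎ Any (λ p → v ∈ verts p) ℒ
  ; inE = λ e → inE H e ⊎ Any (λ p → e ∈ arcs p) ℒ }

_─_ : ∀ {n} → Gr n → Edge n → Gr n
H ─ e = record { inV = inV H ; inE = λ f → inE H f × ¬ (f ≡ e) }

IsMinimal : ∀ {n} → Gr n → (A B : Fin n → Set) → List (Path n) → Set
IsMinimal H A B ℒ =
  ∀ e → e ∈ concatMap arcs ℒ → ¬ inE H e →
  ¬ (Σ (List _) λ ℒ' → IsLinkage ((ℒ ∪ᴸ H) ─ e) A B ℒ' × length ℒ' ≡ length ℒ)

-- Suppose ℒ had more than r = |ℛ| paths. Let H = (𝒫 ∪ ℛ) − e. Every set S of vertices separating
-- A (restricted to H) from B in H has at least r elements. Indeed, if S meets R, then S meets every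
-- path of ℛ: a path of ℛ avoiding S would be a path of H, since only R contains e. If S misses R,
-- then some path Q of ℒ misses S and the tail of e, because |S| + 1 < |ℒ|; following R₁ to Q, then
-- Q, then R₂ from the end of Q gives an A–B walk in H avoiding S. By Menger's theorem H contains r
-- disjoint A–B paths, contradicting the 𝒫-minimality of ℛ.
--
-- Menger's theorem is proved by Göring's induction on the number of arcs. If deleting an arc x y
-- leaves a separator S with |S| < k, then k disjoint paths from A to S ∪ {x} and from S ∪ {y} to B
-- exist in the smaller graph, meet only in S, and are glued along S and along x y.

module Submission where

open import Defs
open import Data.Nat using (ℕ; zero; suc; _≤_; _<_; z≤n; s≤s; _≤?_)
open import Data.Nat.Properties using (≤-trans; ≤-pred; <⇒≤; <⇒≱; ≰⇒>; ≤-reflexive)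
open import Data.Fin using (Fin; _≟_)
open import Data.Product using (Σ-syntax; _×_; _,_; proj₁; proj₂)
open import Data.Product.Properties using (≡-dec)
open import Data.Sum using (_⊎_; inj₁; inj₂)
open import Data.Empty using (⊥; ⊥-elim)
open import Data.List using (List; []; _∷_; length; _++_; map; concatMap; filter)
open import Data.List.Properties using (length-map; ∷-injectiveˡ; ∷-injectiveʳ)
open import Data.List.Membership.Propositional using (_∈_; _∉_; find; lose)
open import Data.List.Membership.Propositional.Properties
  using (∈-++⁺ˡ; ∈-++⁺ʳ; ∈-++⁻; ∈-∃++; ∈-map⁺; ∈-map⁻; ∈-filter⁺; ∈-filter⁻;
         ∈-concatMap⁺; ∈-concatMap⁻)
open import Data.List.Relation.Binary.Subset.Propositional using (_⊆_)
open import Data.List.Relation.Binary.Subset.Propositional.Properties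
  using (⊆-refl; ⊆-trans) renaming (++⁺ to ++-⊆⁺)
open import Data.List.Relation.Binary.Disjoint.Propositional using (Disjoint)
open import Data.List.Relation.Binary.Disjoint.Propositional.Properties
  using () renaming (sym to Disjoint-sym)
open import Data.List.Relation.Unary.All as All using (All; []; _∷_)
open import Data.List.Relation.Unary.All.Properties
  using (anti-mono; ¬Any⇒All¬) renaming (++⁺ to All-++⁺; map⁺ to All-map⁺)
open import Data.List.Relation.Unary.Any as Any using (Any; here; there; any?)
open import Data.List.Relation.Unary.AllPairs as AllPairs using (AllPairs; []; _∷_)
open import Data.List.Relation.Unary.AllPairs.Properties using () renaming (map⁺ to AllPairs-map⁺)
open import Data.List.Relation.Unary.Unique.Propositional using (Unique)
open import Function using (_∘_; _on_)
open import Relation.Binary.PropositionalEquality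
  using (_≡_; _≢_; refl; sym; trans; cong; cong₂; subst; module ≡-Reasoning)
open import Relation.Nullary using (¬_; Dec; yes; no; ¬?; contradiction)
open import Relation.Nullary.Decidable using (decidable-stable)
open import Relation.Binary using (DecidableEquality)
open import Relation.Unary using (Decidable; ∁)

module _ {X : Set} where

  ∈-++-∷⁻ : ∀ us {vs} {u m : X} → u ∈ us ++ m ∷ vs → u ≢ m → u ∈ us ++ vs
  ∈-++-∷⁻ us u∈ u≢m with ∈-++⁻ us u∈
  ... | inj₁ u∈us         = ∈-++⁺ˡ u∈us
  ... | inj₂ (here u≡m)   = contradiction u≡m u≢m
  ... | inj₂ (there u∈vs) = ∈-++⁺ʳ us u∈vs

  length-++-∷ : ∀ us {vs} {m : X} → length (us ++ m ∷ vs) ≡ suc (length (us ++ vs))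
  length-++-∷ []       = refl
  length-++-∷ (_ ∷ us) = cong suc (length-++-∷ us)

  Unique⇒length≤ : {xs ys : List X} → Unique xs → xs ⊆ ys → length xs ≤ length ys
  Unique⇒length≤ [] _ = z≤n
  Unique⇒length≤ {x ∷ xs} (x∉xs ∷ unique) xs⊆ys with ∈-∃++ (xs⊆ys (here refl))
  ... | us , vs , refl = subst (suc (length xs) ≤_) (sym (length-++-∷ us))
          (s≤s (Unique⇒length≤ unique λ w∈xs →
             ∈-++-∷⁻ us (xs⊆ys (there w∈xs)) λ w≡x → All.lookup x∉xs w∈xs (sym w≡x)))

  Unique⇒length≥⇒⊇ : {xs ys : List X} → DecidableEquality X →
    Unique xs → xs ⊆ ys → length ys ≤ length xs → ys ⊆ xs
  Unique⇒length≥⇒⊇ {xs} _≟X_ unique xs⊆ys ys≤xs {z} z∈ys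
    with any? (z ≟X_) xs
  ... | yes z∈xs = z∈xs
  ... | no z∉xs with ∈-∃++ z∈ys
  ...   | us , vs , refl =
    contradiction (subst (_≤ length xs) (length-++-∷ us) ys≤xs) (<⇒≱ (s≤s shorter))
    where
    shorter : length xs ≤ length (us ++ vs)
    shorter = Unique⇒length≤ unique λ w∈xs → ∈-++-∷⁻ us (xs⊆ys w∈xs) λ { refl → z∉xs w∈xs }

  Unique-++⇒Disjoint : ∀ (xs : List X) {ys} → Unique (xs ++ ys) → Disjoint xs ys
  Unique-++⇒Disjoint (x ∷ xs) (x∉ ∷ _) (here refl , u∈ys) = All.lookup x∉ (∈-++⁺ʳ xs u∈ys) refl
  Unique-++⇒Disjoint (x ∷ xs) (_ ∷ u)  (there u∈xs , u∈ys) = Unique-++⇒Disjoint xs u (u∈xs , u∈ys)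

  pigeonhole : {Y : Set} (f : Y → List X) {ys : List Y} {S : List X} →
    AllPairs (Disjoint on f) ys → All (Any (_∈ S) ∘ f) ys → length ys ≤ length S
  pigeonhole f [] [] = z≤n
  pigeonhole f {y ∷ ys} (y#ys ∷ disjoint) (hit ∷ hits) with find hit
  ... | m , m∈y , m∈S with ∈-∃++ m∈S
  ...   | us , vs , refl = subst (suc (length ys) ≤_) (sym (length-++-∷ us))
            (s≤s (pigeonhole f disjoint (All.zipWith misses-m (y#ys , hits))))
    where
    misses-m : ∀ {z} → Disjoint (f y) (f z) × Any (_∈ us ++ m ∷ vs) (f z) →
      Any (_∈ us ++ vs) (f z)
    misses-m (y#z , hit) with find hit
    ... | w , w∈z , w∈S = lose w∈z (∈-++-∷⁻ us w∈S λ { refl → y#z (m∈y , w∈z) })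

  sharing⇒≡ : {Y : Set} {f : Y → List X} {ys : List Y} {a b : Y} {u : X} →
    AllPairs (Disjoint on f) ys → a ∈ ys → b ∈ ys → u ∈ f a → u ∈ f b → a ≡ b
  sharing⇒≡ (_ ∷ _) (here refl) (here refl) _ _ = refl
  sharing⇒≡ (a#ys ∷ _) (here refl) (there b∈) u∈a u∈b = ⊥-elim (All.lookup a#ys b∈ (u∈a , u∈b))
  sharing⇒≡ (b#ys ∷ _) (there a∈) (here refl) u∈a u∈b = ⊥-elim (All.lookup b#ys a∈ (u∈b , u∈a))
  sharing⇒≡ (_ ∷ disjoint) (there a∈) (there b∈) = sharing⇒≡ disjoint a∈ b∈

  AllPairs-mapWithAll : {P : X → Set} {R R′ : X → X → Set} {xs : List X} →
    (∀ {a b} → P a → P b → R a b → R′ a b) → All P xs → AllPairs R xs → AllPairs R′ xs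
  AllPairs-mapWithAll f []        []         = []
  AllPairs-mapWithAll f (pa ∷ ps) (ra ∷ rs) =
    All.zipWith (λ (pb , rab) → f pa pb rab) (ps , ra) ∷ AllPairs-mapWithAll f ps rs

module _ {n : ℕ} where

  end-∈ : ∀ (p : Path n) → end p ∈ verts p
  end-∈ p = go (start p) (rest p)
    where
    go : ∀ s ws → lastFrom s ws ∈ s ∷ ws
    go s []       = here refl
    go s (w ∷ ws) = there (go w ws)

  tail-∈ : ∀ p {a : Edge n} → a ∈ arcs p → proj₁ a ∈ verts p
  tail-∈ p = go (start p) (rest p)
    where
    go : ∀ s ws {a} → a ∈ arcsFrom s ws → proj₁ a ∈ s ∷ ws
    go s (w ∷ ws) (here refl) = here refl
    go s (w ∷ ws) (there a∈)  = there (go w ws a∈)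

  head-∈ : ∀ p {a : Edge n} → a ∈ arcs p → proj₂ a ∈ verts p
  head-∈ p = go (start p) (rest p)
    where
    go : ∀ s ws {a} → a ∈ arcsFrom s ws → proj₂ a ∈ s ∷ ws
    go s (w ∷ ws) (here refl) = there (here refl)
    go s (w ∷ ws) (there a∈)  = there (go w ws a∈)

  verts-injective : ∀ {p q : Path n} → verts p ≡ verts q → p ≡ q
  verts-injective verts≡ = cong₂ path (∷-injectiveˡ verts≡) (∷-injectiveʳ verts≡)

  start∧heads⇒All : ∀ {Q : Fin n → Set} p → Q (start p) → All (Q ∘ proj₂) (arcs p) →
    All Q (verts p)
  start∧heads⇒All {Q} p q-start = go (start p) (rest p) q-start
    where
    go : ∀ s ws → Q s → All (Q ∘ proj₂) (arcsFrom s ws) → All Q (s ∷ ws)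
    go s []       q-s []              = q-s ∷ []
    go s (w ∷ ws) q-s (q-w ∷ q-heads) = q-s ∷ go w ws q-w q-heads

  tails∉⇒≡end : ∀ {D : Fin n → Set} p → All (∁ D ∘ proj₁) (arcs p) →
    ∀ {u} → u ∈ verts p → D u → u ≡ end p
  tails∉⇒≡end {D} p = go (start p) (rest p)
    where
    go : ∀ s ws → All (∁ D ∘ proj₁) (arcsFrom s ws) →
      ∀ {u} → u ∈ s ∷ ws → D u → u ≡ lastFrom s ws
    go s []       _           (here refl) _ = refl
    go s (w ∷ ws) (¬ds ∷ _)   (here refl) d = contradiction d ¬ds
    go s (w ∷ ws) (_ ∷ tails) (there u∈)  d = go w ws tails u∈ d

  heads∉⇒≡start : ∀ {D : Fin n → Set} p → All (∁ D ∘ proj₂) (arcs p) →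
    ∀ {u} → u ∈ verts p → D u → u ≡ start p
  heads∉⇒≡start {D} p = go (start p) (rest p)
    where
    go : ∀ s ws → All (∁ D ∘ proj₂) (arcsFrom s ws) →
      ∀ {u} → u ∈ s ∷ ws → D u → u ≡ s
    go s ws       _             (here refl) _ = refl
    go s (w ∷ ws) (¬dw ∷ heads) (there u∈)  d with go w ws heads u∈ d
    ... | refl = contradiction d ¬dw

  Unique⇒tail≢head : ∀ p → Unique (verts p) →
    ∀ {a : Edge n} → a ∈ arcs p → proj₁ a ≢ proj₂ a
  Unique⇒tail≢head p = go (start p) (rest p)
    where
    go : ∀ s ws → Unique (s ∷ ws) → ∀ {a} → a ∈ arcsFrom s ws → proj₁ a ≢ proj₂ a
    go s (w ∷ ws) (s∉ ∷ _)      (here refl) = All.head s∉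
    go s (w ∷ ws) (_ ∷ unique)  (there a∈)  = go w ws unique a∈

  _▸_ : Path n → Path n → Path n
  P ▸ Q = path (start P) (rest P ++ verts Q)

  ▸-end : ∀ P Q → end (P ▸ Q) ≡ end Q
  ▸-end P Q = go (start P) (rest P)
    where
    go : ∀ s ws → lastFrom s (ws ++ verts Q) ≡ end Q
    go s []       = refl
    go s (w ∷ ws) = go w ws

  ▸-arcs : ∀ P Q → arcs (P ▸ Q) ≡ arcs P ++ (end P , start Q) ∷ arcs Q
  ▸-arcs P Q = go (start P) (rest P)
    where
    go : ∀ s ws →
      arcsFrom s (ws ++ verts Q) ≡ arcsFrom s ws ++ (lastFrom s ws , start Q) ∷ arcs Q
    go s []       = refl
    go s (w ∷ ws) = cong ((s , w) ∷_) (go w ws)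

  module _ {D : Fin n → Set} (D? : Decidable D) where

    upToFirstFrom : Fin n → List (Fin n) → List (Fin n)
    upToFirstFrom s []       = []
    upToFirstFrom s (w ∷ ws) with D? s
    ... | yes _ = []
    ... | no _  = w ∷ upToFirstFrom w ws

    upToFirst : Path n → Path n
    upToFirst (path s ws) = path s (upToFirstFrom s ws)

    upToFirst-verts : ∀ p → verts (upToFirst p) ⊆ verts p
    upToFirst-verts p = go (start p) (rest p)
      where
      go : ∀ s ws → s ∷ upToFirstFrom s ws ⊆ s ∷ ws
      go s []       u∈ = u∈
      go s (w ∷ ws) u∈ with D? s | u∈
      ... | yes _ | here u≡s  = here u≡s
      ... | no _  | here u≡s  = here u≡s
      ... | no _  | there u∈′ = there (go w ws u∈′)

    upToFirst-arcs : ∀ p → arcs (upToFirst p) ⊆ arcs p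
    upToFirst-arcs p = go (start p) (rest p)
      where
      go : ∀ s ws → arcsFrom s (upToFirstFrom s ws) ⊆ arcsFrom s ws
      go s (w ∷ ws) a∈ with D? s | a∈
      ... | no _ | here a≡   = here a≡
      ... | no _ | there a∈′ = there (go w ws a∈′)

    upToFirst-unique : ∀ p → Unique (verts p) → Unique (verts (upToFirst p))
    upToFirst-unique p = go (start p) (rest p)
      where
      go : ∀ s ws → Unique (s ∷ ws) → Unique (s ∷ upToFirstFrom s ws)
      go s []       unique        = unique
      go s (w ∷ ws) (s∉ ∷ unique) with D? s
      ... | yes _ = [] ∷ []
      ... | no _  = anti-mono (upToFirst-verts (path w ws)) s∉ ∷ go w ws unique

    upToFirst-tails : ∀ p → All (∁ D ∘ proj₁) (arcs (upToFirst p))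
    upToFirst-tails p = go (start p) (rest p)
      where
      go : ∀ s ws → All (∁ D ∘ proj₁) (arcsFrom s (upToFirstFrom s ws))
      go s []       = []
      go s (w ∷ ws) with D? s
      ... | yes _ = []
      ... | no ¬d = ¬d ∷ go w ws

    upToFirst-end : ∀ p → Any D (verts p) → D (end (upToFirst p))
    upToFirst-end p = go (start p) (rest p)
      where
      go : ∀ s ws → Any D (s ∷ ws) → D (lastFrom s (upToFirstFrom s ws))
      go s []       (here d) = d
      go s (w ∷ ws) hit with D? s | hit
      ... | yes d | _          = d
      ... | no ¬d | here d     = contradiction d ¬d
      ... | no _  | there hit′ = go w ws hit′

    fromLastFrom : Fin n → List (Fin n) → Path n
    fromLastFrom s []       = path s []
    fromLastFrom s (w ∷ ws) with any? D? (w ∷ ws)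
    ... | yes _ = fromLastFrom w ws
    ... | no _  = path s (w ∷ ws)

    fromLast : Path n → Path n
    fromLast (path s ws) = fromLastFrom s ws

    fromLast-verts : ∀ p → verts (fromLast p) ⊆ verts p
    fromLast-verts p = go (start p) (rest p)
      where
      go : ∀ s ws → verts (fromLastFrom s ws) ⊆ s ∷ ws
      go s []       u∈ = u∈
      go s (w ∷ ws) u∈ with any? D? (w ∷ ws)
      ... | yes _ = there (go w ws u∈)
      ... | no _  = u∈

    fromLast-arcs : ∀ p → arcs (fromLast p) ⊆ arcs p
    fromLast-arcs p = go (start p) (rest p)
      where
      go : ∀ s ws → arcs (fromLastFrom s ws) ⊆ arcsFrom s ws
      go s []       a∈ = a∈
      go s (w ∷ ws) a∈ with any? D? (w ∷ ws)
      ... | yes _ = there (go w ws a∈)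
      ... | no _  = a∈

    fromLast-unique : ∀ p → Unique (verts p) → Unique (verts (fromLast p))
    fromLast-unique p = go (start p) (rest p)
      where
      go : ∀ s ws → Unique (s ∷ ws) → Unique (verts (fromLastFrom s ws))
      go s []       unique       = unique
      go s (w ∷ ws) (s∉ ∷ unique) with any? D? (w ∷ ws)
      ... | yes _ = go w ws unique
      ... | no _  = s∉ ∷ unique

    fromLast-heads : ∀ p → All (∁ D ∘ proj₂) (arcs (fromLast p))
    fromLast-heads p = go (start p) (rest p)
      where
      heads : ∀ {s ws} → All (∁ D) ws → All (∁ D ∘ proj₂) (arcsFrom s ws)
      heads []         = []
      heads (¬d ∷ ¬ds) = ¬d ∷ heads ¬ds
      go : ∀ s ws → All (∁ D ∘ proj₂) (arcs (fromLastFrom s ws))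
      go s []       = []
      go s (w ∷ ws) with any? D? (w ∷ ws)
      ... | yes _   = go w ws
      ... | no ¬hit = heads (¬Any⇒All¬ (w ∷ ws) ¬hit)

    fromLast-start : ∀ p → Any D (verts p) → D (start (fromLast p))
    fromLast-start p = go (start p) (rest p)
      where
      go : ∀ s ws → Any D (s ∷ ws) → D (start (fromLastFrom s ws))
      go s []       (here d) = d
      go s (w ∷ ws) hit with any? D? (w ∷ ws) | hit
      ... | yes hit′ | _          = go w ws hit′
      ... | no _     | here d     = d
      ... | no ¬hit  | there hit′ = contradiction hit′ ¬hit

    fromLast-end : ∀ p → end (fromLast p) ≡ end p
    fromLast-end p = go (start p) (rest p)
      where
      go : ∀ s ws → end (fromLastFrom s ws) ≡ lastFrom s ws
      go s []       = refl
      go s (w ∷ ws) with any? D? (w ∷ ws)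
      ... | yes _ = go w ws
      ... | no _  = refl

  _◂_ : Fin n → Path n → Path n
  s ◂ p = path s (verts p)

  -- Cutting s ◂ p at the last occurrence of s removes every cycle through s.
  fromLast-◂-unique : ∀ s p → Unique (verts p) → Unique (verts (fromLast (s ≟_) (s ◂ p)))
  fromLast-◂-unique s p unique with any? (s ≟_) (verts p)
  ... | yes _   = fromLast-unique (s ≟_) p unique
  ... | no ¬hit = ¬Any⇒All¬ (verts p) ¬hit ∷ unique

  shortcutFrom : Fin n → List (Fin n) → Path n
  shortcutFrom s []       = path s []
  shortcutFrom s (w ∷ ws) = fromLast (s ≟_) (s ◂ shortcutFrom w ws)

  shortcut : Path n → Path n
  shortcut (path s ws) = shortcutFrom s ws

  shortcut-start : ∀ p → start (shortcut p) ≡ start p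
  shortcut-start p = go (start p) (rest p)
    where
    go : ∀ s ws → start (shortcutFrom s ws) ≡ s
    go s []       = refl
    go s (w ∷ ws) = sym (fromLast-start (s ≟_) (s ◂ shortcutFrom w ws) (here refl))

  shortcut-end : ∀ p → end (shortcut p) ≡ end p
  shortcut-end p = go (start p) (rest p)
    where
    go : ∀ s ws → end (shortcutFrom s ws) ≡ lastFrom s ws
    go s []       = refl
    go s (w ∷ ws) = trans (fromLast-end (s ≟_) (s ◂ shortcutFrom w ws)) (go w ws)

  shortcut-verts : ∀ p → verts (shortcut p) ⊆ verts p
  shortcut-verts p = go (start p) (rest p)
    where
    go : ∀ s ws → verts (shortcutFrom s ws) ⊆ s ∷ ws
    go s []       u∈ = u∈
    go s (w ∷ ws) u∈ with fromLast-verts (s ≟_) (s ◂ shortcutFrom w ws) u∈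
    ... | here u≡s  = here u≡s
    ... | there u∈′ = there (go w ws u∈′)

  shortcut-arcs : ∀ p → arcs (shortcut p) ⊆ arcs p
  shortcut-arcs p = go (start p) (rest p)
    where
    go : ∀ s ws → arcs (shortcutFrom s ws) ⊆ arcsFrom s ws
    go s []       a∈ = a∈
    go s (w ∷ ws) a∈ with fromLast-arcs (s ≟_) (s ◂ shortcutFrom w ws) a∈
    ... | here refl = here (cong (s ,_) (shortcut-start (path w ws)))
    ... | there a∈′ = there (go w ws a∈′)

  shortcut-unique : ∀ p → Unique (verts (shortcut p))
  shortcut-unique p = go (start p) (rest p)
    where
    go : ∀ s ws → Unique (verts (shortcutFrom s ws))
    go s []       = [] ∷ []
    go s (w ∷ ws) = fromLast-◂-unique s (shortcutFrom w ws) (go w ws)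

  join : Path n → Path n → Path n
  join P Q = shortcut (P ▸ Q)

  join-end : ∀ P Q → end (join P Q) ≡ end Q
  join-end P Q = trans (shortcut-end (P ▸ Q)) (▸-end P Q)

  join-arcs : ∀ {E} P Q → arcs P ⊆ E → arcs Q ⊆ E →
    (end P , start Q) ∈ E ⊎ end P ≡ start Q → arcs (join P Q) ⊆ E
  join-arcs P Q P⊆E Q⊆E link a∈
    with ∈-++⁻ (arcs P) (subst (_ ∈_) (▸-arcs P Q) (shortcut-arcs (P ▸ Q) a∈)) | link
  ... | inj₁ a∈P         | _              = P⊆E a∈P
  ... | inj₂ (there a∈Q) | _              = Q⊆E a∈Q
  ... | inj₂ (here refl) | inj₁ link∈E    = link∈E
  ... | inj₂ (here refl) | inj₂ end≡start =
    contradiction end≡start (Unique⇒tail≢head (join P Q) (shortcut-unique (P ▸ Q)) a∈)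

  record IsPathOver (E : List (Edge n)) (A B : Fin n → Set) (p : Path n) : Set where
    field
      unique : Unique (verts p)
      arcs⊆  : arcs p ⊆ E
      fromA  : A (start p)
      toB    : B (end p)
  open IsPathOver

  withArcsIn : ∀ {E₁ E₂ A B p} → arcs p ⊆ E₂ → IsPathOver E₁ A B p → IsPathOver E₂ A B p
  withArcsIn p⊆E₂ p-path = record
    { unique = unique p-path ; arcs⊆ = p⊆E₂ ; fromA = fromA p-path ; toB = toB p-path }

  joinAt : Fin n → Path n → Path n → Path n
  joinAt v P Q = join (upToFirst (v ≟_) P) (fromLast (v ≟_) Q)

  joinAt-verts : ∀ v P Q → verts (joinAt v P Q) ⊆ verts P ++ verts Q
  joinAt-verts v P Q = ⊆-trans (shortcut-verts (P′ ▸ Q′))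
    (++-⊆⁺ (upToFirst-verts (v ≟_) P) (fromLast-verts (v ≟_) Q))
    where
    P′ = upToFirst (v ≟_) P
    Q′ = fromLast (v ≟_) Q

  joinAt-isPath : ∀ {E} {A B : Fin n → Set} {v} P Q → v ∈ verts P → v ∈ verts Q →
    arcs P ⊆ E → arcs Q ⊆ E → A (start P) → B (end Q) → IsPathOver E A B (joinAt v P Q)
  joinAt-isPath {A = A} {B} {v} P Q v∈P v∈Q P⊆E Q⊆E a b = record
    { unique = shortcut-unique (P′ ▸ Q′)
    ; arcs⊆  = join-arcs P′ Q′ (P⊆E ∘ upToFirst-arcs (v ≟_) P) (Q⊆E ∘ fromLast-arcs (v ≟_) Q)
                 (inj₂ (trans (sym (upToFirst-end (v ≟_) P v∈P)) (fromLast-start (v ≟_) Q v∈Q)))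
    ; fromA  = subst A (sym (shortcut-start (P′ ▸ Q′))) a
    ; toB    = subst B (sym (trans (join-end P′ Q′) (fromLast-end (v ≟_) Q))) b
    }
    where
    P′ = upToFirst (v ≟_) P
    Q′ = fromLast (v ≟_) Q

  -- Menger's theorem

  open import Data.List.Membership.DecPropositional (_≟_ {n}) using (_∈?_)

  _≟ᴱ_ : (a b : Edge n) → Dec (a ≡ b)
  _≟ᴱ_ = ≡-dec _≟_ _≟_

  _avoids_ : Path n → List (Fin n) → Set
  p avoids S = All (_∉ S) (verts p)

  meets⊎avoids : ∀ S p → Any (_∈ S) (verts p) ⊎ p avoids S
  meets⊎avoids S p with any? (_∈? S) (verts p)
  ... | yes hit = inj₁ hit
  ... | no ¬hit = inj₂ (¬Any⇒All¬ (verts p) ¬hit)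

  map-disjoint : ∀ {ℒ} (f : Path n → Path n) → (∀ p → verts (f p) ⊆ verts p) →
    AllPairs (Disjoint on verts) ℒ → AllPairs (Disjoint on verts) (map f ℒ)
  map-disjoint f f⊆ = AllPairs-map⁺ ∘ AllPairs.map λ {p} {q} p#q {_} (u∈fp , u∈fq) →
    p#q (f⊆ p u∈fp , f⊆ q u∈fq)

  ends-distinct : ∀ {P Q} → Disjoint (verts P) (verts Q) → end P ≢ end Q
  ends-distinct {P} {Q} P#Q end≡ = P#Q (end-∈ P , subst (_∈ verts Q) (sym end≡) (end-∈ Q))

  Separates : List (Edge n) → (A B : Fin n → Set) → List (Fin n) → Set
  Separates E A B S = ∀ p → IsPathOver E A B p → ¬ p avoids S

  Connectivity≥ : List (Edge n) → (A B : Fin n → Set) → ℕ → Set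
  Connectivity≥ E A B k = ∀ S → Separates E A B S → k ≤ length S

  IsLinkageOver : List (Edge n) → (A B : Fin n → Set) → List (Path n) → Set
  IsLinkageOver E A B ℒ = All (IsPathOver E A B) ℒ × AllPairs (Disjoint on verts) ℒ

  LinkageOfOrder : List (Edge n) → (A B : Fin n → Set) → ℕ → Set
  LinkageOfOrder E A B k = Σ[ ℒ ∈ List (Path n) ] IsLinkageOver E A B ℒ × length ℒ ≡ k

  arcless⇒≡start : ∀ (p : Path n) → arcs p ⊆ [] → ∀ {u} → u ∈ verts p → u ≡ start p
  arcless⇒≡start (path s [])      _    (here refl) = refl
  arcless⇒≡start (path s (w ∷ _)) none _ with none (here refl)
  ... | ()

  menger-arcless : ∀ {A B} k → Connectivity≥ [] A B k → ¬ ¬ LinkageOfOrder [] A B k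
  menger-arcless zero _ ¬linkage = ¬linkage ([] , ([] , []) , refl)
  menger-arcless {A} {B} (suc k) conn ¬linkage =
    menger-arcless k (λ S separates → <⇒≤ (conn S separates)) ¬linkage-k
    where
    ¬linkage-k : ¬ LinkageOfOrder [] A B k
    ¬linkage-k (ℒ , (paths , disjoint) , |ℒ|≡k) =
      <⇒≱ (conn (map start ℒ) separates) (≤-reflexive (trans (length-map start ℒ) |ℒ|≡k))
      where
      separates : Separates [] A B (map start ℒ)
      separates p p-path p-avoids =
        ¬linkage (p ∷ ℒ , (p-path ∷ paths , All.tabulate p#q ∷ disjoint) , cong suc |ℒ|≡k)
        where
        p#q : ∀ {q} → q ∈ ℒ → Disjoint (verts p) (verts q)
        p#q {q} q∈ℒ (u∈p , u∈q) = All.lookup p-avoids u∈p (subst (_∈ map start ℒ)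
          (sym (arcless⇒≡start q (arcs⊆ (All.lookup paths q∈ℒ)) u∈q)) (∈-map⁺ start q∈ℒ))

  module Göring {x y : Fin n} {E′ : List (Edge n)} {A B : Fin n → Set} {k : ℕ}
    (menger′ : ∀ A′ B′ → Connectivity≥ E′ A′ B′ k → ¬ ¬ LinkageOfOrder E′ A′ B′ k)
    (conn : Connectivity≥ ((x , y) ∷ E′) A B k)
    (¬linkage : ¬ LinkageOfOrder ((x , y) ∷ E′) A B k)
    {S : List (Fin n)} (|S|<k : length S < k) (separates : Separates E′ A B S) where

    E Sx Sy : List _
    E  = (x , y) ∷ E′
    Sx = x ∷ S
    Sy = y ∷ S

    uses-xy : ∀ {p} → IsPathOver E A B p → p avoids S → (x , y) ∈ arcs p
    uses-xy {p} p-path p-avoids with any? ((x , y) ≟ᴱ_) (arcs p)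
    ... | yes xy∈p = xy∈p
    ... | no xy∉p  = contradiction p-avoids (separates p (withArcsIn arcs⊆E′ p-path))
      where
      arcs⊆E′ : arcs p ⊆ E′
      arcs⊆E′ a∈p with arcs⊆ p-path a∈p
      ... | here refl  = contradiction a∈p xy∉p
      ... | there a∈E′ = a∈E′

    -- Every path of E avoiding S uses x y, so y ∈ S would make S a small separator in E.
    y∉S : y ∉ S
    y∉S y∈S = <⇒≱ |S|<k (conn S λ p p-path p-avoids →
      All.lookup p-avoids (head-∈ p (uses-xy p-path p-avoids)) y∈S)

    meets-Sx : ∀ {p} → IsPathOver E A B p → Any (_∈ Sx) (verts p)
    meets-Sx {p} p-path with meets⊎avoids S p
    ... | inj₁ hit      = Any.map there hit
    ... | inj₂ p-avoids = lose (tail-∈ p (uses-xy p-path p-avoids)) (here refl)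

    meets-Sy : ∀ {p} → IsPathOver E A B p → Any (_∈ Sy) (verts p)
    meets-Sy {p} p-path with meets⊎avoids S p
    ... | inj₁ hit      = Any.map there hit
    ... | inj₂ p-avoids = lose (head-∈ p (uses-xy p-path p-avoids)) (here refl)

    EntersSx LeavesSy : Path n → Set
    EntersSx P = IsPathOver E′ A (_∈ Sx) P × All (∁ (_∈ Sx) ∘ proj₁) (arcs P)
    LeavesSy Q = IsPathOver E′ (_∈ Sy) B Q × All (∁ (_∈ Sy) ∘ proj₂) (arcs Q)

    upToSx fromSy : Path n → Path n
    upToSx = upToFirst (_∈? Sx)
    fromSy = fromLast (_∈? Sy)

    -- The trimmed path cannot use x y, whose tail x lies in Sx.
    upToSx-enters : ∀ {p} → Unique (verts p) → arcs p ⊆ E → A (start p) → Any (_∈ Sx) (verts p) →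
      EntersSx (upToSx p)
    upToSx-enters {p} p-unique p⊆E a hit = record
      { unique = upToFirst-unique (_∈? Sx) p p-unique
      ; arcs⊆  = arcs⊆E′
      ; fromA  = a
      ; toB    = upToFirst-end (_∈? Sx) p hit
      } , upToFirst-tails (_∈? Sx) p
      where
      arcs⊆E′ : arcs (upToSx p) ⊆ E′
      arcs⊆E′ a∈ with p⊆E (upToFirst-arcs (_∈? Sx) p a∈)
      ... | here refl  = contradiction (here refl) (All.lookup (upToFirst-tails (_∈? Sx) p) a∈)
      ... | there a∈E′ = a∈E′

    fromSy-leaves : ∀ {p} → Unique (verts p) → arcs p ⊆ E → B (end p) → Any (_∈ Sy) (verts p) →
      LeavesSy (fromSy p)
    fromSy-leaves {p} p-unique p⊆E b hit = record
      { unique = fromLast-unique (_∈? Sy) p p-unique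
      ; arcs⊆  = arcs⊆E′
      ; fromA  = fromLast-start (_∈? Sy) p hit
      ; toB    = subst B (sym (fromLast-end (_∈? Sy) p)) b
      } , fromLast-heads (_∈? Sy) p
      where
      arcs⊆E′ : arcs (fromSy p) ⊆ E′
      arcs⊆E′ a∈ with p⊆E (fromLast-arcs (_∈? Sy) p a∈)
      ... | here refl  = contradiction (here refl) (All.lookup (fromLast-heads (_∈? Sy) p) a∈)
      ... | there a∈E′ = a∈E′

    conn-Sx : Connectivity≥ E′ A (_∈ Sx) k
    conn-Sx T separates-T = conn T λ p p-path p-avoids →
      separates-T (upToSx p)
        (proj₁ (upToSx-enters (unique p-path) (arcs⊆ p-path) (fromA p-path) (meets-Sx p-path)))
        (anti-mono (upToFirst-verts (_∈? Sx) p) p-avoids)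

    conn-Sy : Connectivity≥ E′ (_∈ Sy) B k
    conn-Sy T separates-T = conn T λ p p-path p-avoids →
      separates-T (fromSy p)
        (proj₁ (fromSy-leaves (unique p-path) (arcs⊆ p-path) (toB p-path) (meets-Sy p-path)))
        (anti-mono (fromLast-verts (_∈? Sy) p) p-avoids)

    -- A common vertex outside S would give an A–B path of E′ avoiding S.
    meet-in-S : ∀ {P Q v} → EntersSx P → LeavesSy Q → v ∈ verts P → v ∈ verts Q →
      v ∈ S × v ≡ end P × v ≡ start Q
    meet-in-S {P} {Q} {v} (P-path , P-tails) (Q-path , Q-heads) v∈P v∈Q with v ∈? S
    ... | yes v∈S =
      v∈S , tails∉⇒≡end P P-tails v∈P (there v∈S) , heads∉⇒≡start Q Q-heads v∈Q (there v∈S)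
    ... | no v∉S  = contradiction detour-avoids (separates detour detour-path)
      where
      detour = joinAt v P Q
      detour-path = joinAt-isPath P Q v∈P v∈Q (arcs⊆ P-path) (arcs⊆ Q-path)
                      (fromA P-path) (toB Q-path)
      P′ = upToFirst (v ≟_) P
      Q′ = fromLast (v ≟_) Q
      P′-avoids : P′ avoids S
      P′-avoids = All.tabulate λ u∈P′ u∈S → v∉S (subst (_∈ S)
        (trans (tails∉⇒≡end P′ (anti-mono (upToFirst-arcs (v ≟_) P) P-tails) u∈P′ (there u∈S))
               (sym (upToFirst-end (v ≟_) P v∈P))) u∈S)
      Q′-avoids : Q′ avoids S
      Q′-avoids = All.tabulate λ u∈Q′ u∈S → v∉S (subst (_∈ S)
        (trans (heads∉⇒≡start Q′ (anti-mono (fromLast-arcs (v ≟_) Q) Q-heads) u∈Q′ (there u∈S))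
               (sym (fromLast-start (v ≟_) Q v∈Q))) u∈S)
      detour-avoids : detour avoids S
      detour-avoids = anti-mono (shortcut-verts (P′ ▸ Q′)) (All-++⁺ P′-avoids Q′-avoids)

    -- A path of L₁ ending in s ∈ S continues along the path of L₂ starting in s;
    -- the one ending in x continues through the arc x y.
    continueAt : Fin n → Fin n
    continueAt z with z ≟ x
    ... | yes _ = y
    ... | no _  = z

    ∈Sx⇒≢x⇒∈S : ∀ {z} → z ∈ Sx → z ≢ x → z ∈ S
    ∈Sx⇒≢x⇒∈S (here z≡x)  z≢x = contradiction z≡x z≢x
    ∈Sx⇒≢x⇒∈S (there z∈S) _   = z∈S

    continueAt-∈Sy : ∀ {z} → z ∈ Sx → continueAt z ∈ Sy
    continueAt-∈Sy {z} z∈Sx with z ≟ x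
    ... | yes _   = here refl
    ... | no z≢x  = there (∈Sx⇒≢x⇒∈S z∈Sx z≢x)

    continueAt-link : ∀ z → (z , continueAt z) ∈ E ⊎ z ≡ continueAt z
    continueAt-link z with z ≟ x
    ... | yes refl = inj₁ (here refl)
    ... | no _     = inj₂ refl

    continueAt-∈S : ∀ {z} → continueAt z ∈ S → z ≡ continueAt z
    continueAt-∈S {z} c∈S with z ≟ x
    ... | yes _ = contradiction c∈S y∉S
    ... | no _  = refl

    continueAt-injective : ∀ {z z′} → z ∈ Sx → z′ ∈ Sx →
      continueAt z ≡ continueAt z′ → z ≡ z′
    continueAt-injective {z} {z′} z∈Sx z′∈Sx c≡c′ with z ≟ x | z′ ≟ x
    ... | yes refl | yes refl = refl
    ... | yes _    | no z′≢x  = ⊥-elim (y∉S (subst (_∈ S) (sym c≡c′) (∈Sx⇒≢x⇒∈S z′∈Sx z′≢x)))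
    ... | no z≢x   | yes _    = ⊥-elim (y∉S (subst (_∈ S) c≡c′ (∈Sx⇒≢x⇒∈S z∈Sx z≢x)))
    ... | no _     | no _     = c≡c′

    module Combine {L₁ L₂ : List (Path n)}
      (L₁-enter : All EntersSx L₁) (L₁-disjoint : AllPairs (Disjoint on verts) L₁)
      (|L₁| : length L₁ ≡ k)
      (L₂-leave : All LeavesSy L₂) (L₂-disjoint : AllPairs (Disjoint on verts) L₂)
      (|L₂| : length L₂ ≡ k)
      where

      -- The k distinct starts of L₂ lie in the set Sy of at most k vertices, so they exhaust it.
      Sy⊆starts : Sy ⊆ map start L₂
      Sy⊆starts = Unique⇒length≥⇒⊇ _≟_ starts-unique starts⊆Sy
        (subst (length Sy ≤_) (sym (trans (length-map start L₂) |L₂|)) |S|<k)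
        where
        starts-unique : Unique (map start L₂)
        starts-unique = AllPairs-map⁺
          (AllPairs.map (λ P#Q start≡ → P#Q (here refl , here start≡)) L₂-disjoint)
        starts⊆Sy : map start L₂ ⊆ Sy
        starts⊆Sy u∈ with ∈-map⁻ start u∈
        ... | Q , Q∈L₂ , refl = fromA (proj₁ (All.lookup L₂-leave Q∈L₂))

      partner : Fin n → Path n
      partner z with any? ((z ≟_) ∘ start) L₂
      ... | yes hit = proj₁ (find hit)
      ... | no _    = path z []

      partner-∈ : ∀ {z} → z ∈ Sy → partner z ∈ L₂ × z ≡ start (partner z)
      partner-∈ {z} z∈Sy with any? ((z ≟_) ∘ start) L₂
      ... | yes hit = proj₂ (find hit)
      ... | no ¬hit with ∈-map⁻ start (Sy⊆starts z∈Sy)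
      ...   | Q , Q∈L₂ , z≡start = contradiction (lose Q∈L₂ z≡start) ¬hit

      next : Path n → Path n
      next P = partner (continueAt (end P))

      next-∈ : ∀ {P} → EntersSx P → next P ∈ L₂ × continueAt (end P) ≡ start (next P)
      next-∈ (P-path , _) = partner-∈ (continueAt-∈Sy (toB P-path))

      next-leaves : ∀ {P} → EntersSx P → LeavesSy (next P)
      next-leaves P-enters = All.lookup L₂-leave (proj₁ (next-∈ P-enters))

      extend : Path n → Path n
      extend P = join P (next P)

      extend-isPath : ∀ {P} → EntersSx P → IsPathOver E A B (extend P)
      extend-isPath {P} P-enters@(P-path , _) = record
        { unique = shortcut-unique (P ▸ Q)
        ; arcs⊆  = join-arcs P Q (there ∘ arcs⊆ P-path) (there ∘ arcs⊆ Q-path)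
                     (subst (λ z → (end P , z) ∈ E ⊎ end P ≡ z) (proj₂ (next-∈ P-enters))
                            (continueAt-link (end P)))
        ; fromA  = subst A (sym (shortcut-start (P ▸ Q))) (fromA P-path)
        ; toB    = subst B (sym (join-end P Q)) (toB Q-path)
        }
        where
        Q = next P
        Q-path = proj₁ (next-leaves P-enters)

      crossing : ∀ {P P′ u} → EntersSx P → EntersSx P′ → Disjoint (verts P) (verts P′) →
        u ∈ verts P → u ∈ verts (next P′) → ⊥
      crossing {P} {P′} {u} P-enters P′-enters P#P′ u∈P u∈Q′
        with meet-in-S P-enters (next-leaves P′-enters) u∈P u∈Q′
      ... | u∈S , u≡end , u≡start = ends-distinct P#P′ (begin
        end P                ≡⟨ sym u≡end ⟩
        u                    ≡⟨ u≡c ⟩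
        continueAt (end P′)  ≡⟨ sym (continueAt-∈S (subst (_∈ S) u≡c u∈S)) ⟩
        end P′               ∎)
        where
        open ≡-Reasoning
        u≡c = trans u≡start (sym (proj₂ (next-∈ P′-enters)))

      extend-disjoint : ∀ {P P′} → EntersSx P → EntersSx P′ → Disjoint (verts P) (verts P′) →
        Disjoint (verts (extend P)) (verts (extend P′))
      extend-disjoint {P} {P′} P-enters P′-enters P#P′ (u∈J , u∈J′)
        with ∈-++⁻ (verts P)  (shortcut-verts (P ▸ next P) u∈J)
           | ∈-++⁻ (verts P′) (shortcut-verts (P′ ▸ next P′) u∈J′)
      ... | inj₁ u∈P | inj₁ u∈P′ = P#P′ (u∈P , u∈P′)
      ... | inj₁ u∈P | inj₂ u∈Q′ = crossing P-enters P′-enters P#P′ u∈P u∈Q′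
      ... | inj₂ u∈Q | inj₁ u∈P′ = crossing P′-enters P-enters (Disjoint-sym P#P′) u∈P′ u∈Q
      ... | inj₂ u∈Q | inj₂ u∈Q′ = ends-distinct P#P′
        (continueAt-injective (toB (proj₁ P-enters)) (toB (proj₁ P′-enters)) (begin
          continueAt (end P)   ≡⟨ proj₂ (next-∈ P-enters) ⟩
          start (next P)       ≡⟨ cong start (sharing⇒≡ L₂-disjoint
                                    (proj₁ (next-∈ P-enters)) (proj₁ (next-∈ P′-enters)) u∈Q u∈Q′) ⟩
          start (next P′)      ≡⟨ sym (proj₂ (next-∈ P′-enters)) ⟩
          continueAt (end P′)  ∎))
        where open ≡-Reasoning

      linkage : LinkageOfOrder E A B k
      linkage = map extend L₁
              , ( All-map⁺ (All.map extend-isPath L₁-enter)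
                , AllPairs-map⁺ (AllPairs-mapWithAll extend-disjoint L₁-enter L₁-disjoint))
              , trans (length-map extend L₁) |L₁|

    TrimmedLinkage : (Path n → Set) → Set
    TrimmedLinkage Trimmed =
      Σ[ L ∈ List (Path n) ] All Trimmed L × AllPairs (Disjoint on verts) L × length L ≡ k

    trim-Sx : LinkageOfOrder E′ A (_∈ Sx) k → TrimmedLinkage EntersSx
    trim-Sx (L , (paths , disjoint) , |L|) =
      map upToSx L ,
      All-map⁺ (All.map (λ {P} P-path → upToSx-enters (unique P-path) (there ∘ arcs⊆ P-path)
                           (fromA P-path) (lose (end-∈ P) (toB P-path))) paths) ,
      map-disjoint upToSx (upToFirst-verts (_∈? Sx)) disjoint ,
      trans (length-map upToSx L) |L|

    trim-Sy : LinkageOfOrder E′ (_∈ Sy) B k → TrimmedLinkage LeavesSy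
    trim-Sy (L , (paths , disjoint) , |L|) =
      map fromSy L ,
      All-map⁺ (All.map (λ Q-path → fromSy-leaves (unique Q-path) (there ∘ arcs⊆ Q-path)
                           (toB Q-path) (lose (here refl) (fromA Q-path))) paths) ,
      map-disjoint fromSy (fromLast-verts (_∈? Sy)) disjoint ,
      trans (length-map fromSy L) |L|

    combine : TrimmedLinkage EntersSx → TrimmedLinkage LeavesSy → LinkageOfOrder E A B k
    combine (_ , L₁-enter , L₁-disjoint , |L₁|) (_ , L₂-leave , L₂-disjoint , |L₂|) =
      Combine.linkage L₁-enter L₁-disjoint |L₁| L₂-leave L₂-disjoint |L₂|

    absurd : ⊥
    absurd = menger′ A (_∈ Sx) conn-Sx λ L₁ → menger′ (_∈ Sy) B conn-Sy λ L₂ →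
      ¬linkage (combine (trim-Sx L₁) (trim-Sy L₂))

  -- A and B are arbitrary predicates, so whether a small separator exists is undecidable;
  -- hence the double negation.
  menger : ∀ E {A B} k → Connectivity≥ E A B k → ¬ ¬ LinkageOfOrder E A B k
  menger []             k = menger-arcless k
  menger ((x , y) ∷ E′) {A} {B} k conn ¬linkage = menger E′ k conn′ (¬linkage ∘ weaken)
    where
    weaken : LinkageOfOrder E′ A B k → LinkageOfOrder ((x , y) ∷ E′) A B k
    weaken (ℒ , (paths , disjoint) , |ℒ|) =
      ℒ , (All.map (λ p-path → withArcsIn (there ∘ arcs⊆ p-path) p-path) paths , disjoint) , |ℒ|
    conn′ : Connectivity≥ E′ A B k
    conn′ S separates with k ≤? length S
    ... | yes k≤|S| = k≤|S|
    ... | no k≰|S|  = ⊥-elim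
      (Göring.absurd (λ A′ B′ → menger E′ {A′} {B′} k) conn ¬linkage (≰⇒> k≰|S|) separates)

  -- Minimal linkages

  module MinimalLinkage {P K : Gr n} {A B : Fin n → Set} {ℛ ℒ : List (Path n)} {R₁ R₂ : Path n}
    (ℛ-linkage : IsLinkage K A B ℛ) (ℛ-minimal : IsMinimal P A B ℛ)
    (R∈ℛ : R₁ ▸ R₂ ∈ ℛ) (e∉P : ¬ inE P (end R₁ , start R₂))
    (ℒ-linkage : IsLinkage (ℛ ∪ᴸ P) (_∈ verts R₁) (_∈ verts R₂) ℒ)
    (ℛ<ℒ : length ℛ < length ℒ) where

    R = R₁ ▸ R₂
    e = (end R₁ , start R₂)
    H = (ℛ ∪ᴸ P) ─ e

    e∈R : e ∈ arcs R
    e∈R = subst (e ∈_) (sym (▸-arcs R₁ R₂)) (∈-++⁺ʳ (arcs R₁) (here refl))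

    R-unique : Unique (verts R₁ ++ verts R₂)
    R-unique = proj₁ (proj₁ (All.lookup (proj₁ ℛ-linkage) R∈ℛ))

    R#R : Disjoint (verts R₁) (verts R₂)
    R#R = Unique-++⇒Disjoint (verts R₁) R-unique

    E₀ : List (Edge n)
    E₀ = filter (λ a → ¬? (a ≟ᴱ e)) (concatMap arcs (ℛ ++ ℒ))

    -- A path without arcs is a single vertex, which has to lie in H.
    A₀ : Fin n → Set
    A₀ v = A v × inV H v

    ∈E₀⁺ : ∀ {p a} → p ∈ ℛ ++ ℒ → a ∈ arcs p → a ≢ e → a ∈ E₀
    ∈E₀⁺ p∈ a∈p = ∈-filter⁺ (λ a → ¬? (a ≟ᴱ e)) (∈-concatMap⁺ arcs (lose p∈ a∈p))

    inside-ℛ∪P : ∀ {p} → p ∈ ℛ ++ ℒ → All (inV H) (verts p) × All (inE (ℛ ∪ᴸ P)) (arcs p)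
    inside-ℛ∪P {p} p∈ with ∈-++⁻ ℛ p∈
    ... | inj₁ p∈ℛ = All.tabulate (inj₂ ∘ lose p∈ℛ) , All.tabulate (inj₂ ∘ lose p∈ℛ)
    ... | inj₂ p∈ℒ = let (_ , in-V , in-E) , _ = All.lookup (proj₁ ℒ-linkage) p∈ℒ in in-V , in-E

    E₀-in-H : ∀ {a} → a ∈ E₀ → inE H a × inV H (proj₂ a)
    E₀-in-H a∈E₀ with ∈-filter⁻ (λ a → ¬? (a ≟ᴱ e)) a∈E₀
    ... | a∈ , a≢e with find (∈-concatMap⁻ arcs a∈)
    ...   | p , p∈ , a∈p = let p-verts , p-arcs = inside-ℛ∪P p∈ in
      (All.lookup p-arcs a∈p , a≢e) , All.lookup p-verts (head-∈ p a∈p)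

    pathOver⇒pathIn : ∀ {p} → IsPathOver E₀ A₀ B p → IsPathIn H p × A (start p) × B (end p)
    pathOver⇒pathIn {p} p-path =
      ( unique p-path
      , start∧heads⇒All p (proj₂ (fromA p-path)) (All.tabulate (proj₂ ∘ E₀-in-H ∘ arcs⊆ p-path))
      , All.tabulate (proj₁ ∘ E₀-in-H ∘ arcs⊆ p-path))
      , proj₁ (fromA p-path) , toB p-path

    ℛ-path : ∀ {R′} → R′ ∈ ℛ → e ∉ arcs R′ → IsPathOver E₀ A₀ B R′
    ℛ-path R′∈ℛ e∉R′ = let (R′-unique , _) , a , b = All.lookup (proj₁ ℛ-linkage) R′∈ℛ in record
      { unique = R′-unique
      ; arcs⊆  = λ a∈ → ∈E₀⁺ (∈-++⁺ˡ R′∈ℛ) a∈ λ { refl → e∉R′ a∈ }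
      ; fromA  = a , inj₂ (lose R′∈ℛ (here refl))
      ; toB    = b
      }

    -- R₁, then Q, then R₂: the way around e opened up by a path Q of ℒ that misses end R₁.
    detour : Path n → Path n
    detour Q = joinAt (end Q) (joinAt (start Q) R₁ Q) R₂

    detour-path : ∀ {Q} → Q ∈ ℒ → e ∉ arcs Q → IsPathOver E₀ A₀ B (detour Q)
    detour-path {Q} Q∈ℒ e∉Q = joinAt-isPath R₁Q R₂
      (subst (_∈ verts R₁Q) (toB R₁Q-path) (end-∈ R₁Q)) end∈R₂
      (arcs⊆ R₁Q-path) R₂⊆E₀ (fromA R₁Q-path) (subst B (▸-end R₁ R₂) b)
      where
      start∈R₁ = proj₁ (proj₂ (All.lookup (proj₁ ℒ-linkage) Q∈ℒ))
      end∈R₂   = proj₂ (proj₂ (All.lookup (proj₁ ℒ-linkage) Q∈ℒ))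
      b        = proj₂ (proj₂ (All.lookup (proj₁ ℛ-linkage) R∈ℛ))
      a        = proj₁ (proj₂ (All.lookup (proj₁ ℛ-linkage) R∈ℛ))
      R₁⊆E₀ : arcs R₁ ⊆ E₀
      R₁⊆E₀ a∈ = ∈E₀⁺ (∈-++⁺ˡ R∈ℛ) (subst (_ ∈_) (sym (▸-arcs R₁ R₂)) (∈-++⁺ˡ a∈))
        λ { refl → R#R (head-∈ R₁ a∈ , here refl) }
      R₂⊆E₀ : arcs R₂ ⊆ E₀
      R₂⊆E₀ a∈ =
        ∈E₀⁺ (∈-++⁺ˡ R∈ℛ) (subst (_ ∈_) (sym (▸-arcs R₁ R₂)) (∈-++⁺ʳ (arcs R₁) (there a∈)))
        λ { refl → R#R (end-∈ R₁ , tail-∈ R₂ a∈) }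
      Q⊆E₀ : arcs Q ⊆ E₀
      Q⊆E₀ a∈ = ∈E₀⁺ (∈-++⁺ʳ ℛ Q∈ℒ) a∈ λ { refl → e∉Q a∈ }
      R₁Q = joinAt (start Q) R₁ Q
      R₁Q-path : IsPathOver E₀ A₀ (_≡ end Q) R₁Q
      R₁Q-path = joinAt-isPath R₁ Q start∈R₁ (here refl) R₁⊆E₀ Q⊆E₀
        (a , inj₂ (lose R∈ℛ (here refl))) refl

    detour-avoids : ∀ {Q S} → R avoids S → Q avoids S → detour Q avoids S
    detour-avoids {Q} {S} R-avoids Q-avoids =
      anti-mono (⊆-trans (joinAt-verts (end Q) (joinAt (start Q) R₁ Q) R₂)
                         (++-⊆⁺ (joinAt-verts (start Q) R₁ Q) ⊆-refl))
        (All-++⁺ (All-++⁺ R₁-avoids Q-avoids) R₂-avoids)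
      where
      R₁-avoids : R₁ avoids S
      R₁-avoids = anti-mono ∈-++⁺ˡ R-avoids
      R₂-avoids : R₂ avoids S
      R₂-avoids = anti-mono (∈-++⁺ʳ (verts R₁)) R-avoids

    conn₀ : Connectivity≥ E₀ A₀ B (length ℛ)
    conn₀ S separates with meets⊎avoids S R
    ... | inj₁ R-meets  = pigeonhole verts (proj₂ ℛ-linkage) (All.tabulate ℛ-meets)
      where
      ℛ-meets : ∀ {R′} → R′ ∈ ℛ → Any (_∈ S) (verts R′)
      ℛ-meets {R′} R′∈ℛ with meets⊎avoids S R′ | any? (e ≟ᴱ_) (arcs R′)
      ... | inj₁ R′-meets  | _        = R′-meets
      ... | inj₂ _         | yes e∈R′ = subst (λ Z → Any (_∈ S) (verts Z))
            (sharing⇒≡ (proj₂ ℛ-linkage) R∈ℛ R′∈ℛ (tail-∈ R e∈R) (tail-∈ R′ e∈R′))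
            R-meets
      ... | inj₂ R′-avoids | no e∉R′  = contradiction R′-avoids (separates R′ (ℛ-path R′∈ℛ e∉R′))
    ... | inj₂ R-avoids =
      ≤-pred (≤-trans ℛ<ℒ (pigeonhole verts (proj₂ ℒ-linkage) (All.tabulate ℒ-meets)))
      where
      ℒ-meets : ∀ {Q} → Q ∈ ℒ → Any (_∈ end R₁ ∷ S) (verts Q)
      ℒ-meets {Q} Q∈ℒ with meets⊎avoids (end R₁ ∷ S) Q
      ... | inj₁ Q-meets  = Q-meets
      ... | inj₂ Q-avoids = contradiction (detour-avoids R-avoids (All.map (_∘ there) Q-avoids))
            (separates (detour Q)
              (detour-path Q∈ℒ λ e∈Q → All.lookup Q-avoids (tail-∈ Q e∈Q) (here refl)))

    absurd : ⊥
    absurd = menger E₀ (length ℛ) conn₀ λ (ℒ′ , (paths , disjoint) , |ℒ′|) →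
      ℛ-minimal e (∈-concatMap⁺ arcs (lose R∈ℛ e∈R)) e∉P
        (ℒ′ , (All.map pathOver⇒pathIn paths , disjoint) , |ℒ′|)

lemma2p13 : ∀ {n} (G : Digraph n) (P : Gr n) → SubgraphOf P G →
    (A B : Fin n → Set) (ℛ : List (Path n)) →
    IsLinkage (whole G) A B ℛ → IsMinimal P A B ℛ →
    (R : Path n) → R ∈ ℛ → (e : Edge n) → e ∈ arcs R → ¬ inE P e →
    (R₁ R₂ : Path n) → verts R ≡ verts R₁ ++ verts R₂ →
    end R₁ ≡ proj₁ e → start R₂ ≡ proj₂ e →
    (ℒ : List (Path n)) →
    IsLinkage (ℛ ∪ᴸ P) (λ v → v ∈ verts R₁) (λ v → v ∈ verts R₂) ℒ →
    length ℒ ≤ length ℛ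
lemma2p13 G P _ A B ℛ ℛ-linkage ℛ-minimal R R∈ℛ e _ e∉P R₁ R₂ R-split end≡ start≡ ℒ ℒ-linkage =
  decidable-stable (length ℒ ≤? length ℛ) λ ℒ≰ℛ →
    MinimalLinkage.absurd {P = P} {whole G} {A} {B} {ℛ} {ℒ} {R₁} {R₂} ℛ-linkage ℛ-minimal
      (subst (_∈ ℛ) (verts-injective R-split) R∈ℛ)
      (subst (¬_ ∘ inE P) (cong₂ _,_ (sym end≡) (sym start≡)) e∉P)
      ℒ-linkage (≰⇒> ℒ≰ℛ)
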